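{- The sylvester monoid satisfies the identity $xyxy = yxxy$; that is, for all $x,y \in \mathcal{A}^*$, $xyxy \equiv_{\mathrm{sylv}} yxxy$.
   Context: $\mathcal{A} = \{1,2,3,\ldots\}$ with the usual order; $\mathcal{A}^*$ the free monoid over $\mathcal{A}$. A right strict binary search tree is a labelled rooted binary tree where each node's label is $\ge$ all labels in its left subtree and $<$ all labels in its right subtree. $\mathrm{rtree}(a_1\cdots a_k)$ is obtained from the empty tree by inserting $a_k,\ldots,a_1$ in turn, where inserting $a$ creates a node labelled $a$ if the tree is empty and otherwise recurses into the left subtree if $a \le$ root label and into the right subtree otherwise. The sylvester congruence is $u \equiv_{\mathrm{sylv}} v$ iff $\mathrm{rtree}(u) = \mathrm{rtree}(v)$, and the sylvester monoid is $\mathcal{A}^*/{\equiv_{\mathrm{sylv}}}$. (Equivalently, $\equiv_{\mathrm{sylv}}$ is the congruence generated by $cavb \equiv acvb$ for $a \le b < c$, $v \in \mathcal{A}^*$.) -}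

module Defs where

open import Data.Nat using (ℕ; zero; suc; _≤?_; NonZero)
open import Data.List using (List; []; _∷_; foldr)
open import Data.Product using (Σ)
open import Relation.Nullary using (yes; no)
open import Relation.Binary.PropositionalEquality using (_≡_)

𝒜 : Set
𝒜 = Σ ℕ NonZero

open import Data.Product using (proj₁)

Word : Set
Word = List 𝒜

data Tree : Set where
  leaf : Tree
  node : Tree → 𝒜 → Tree → Tree

insert : 𝒜 → Tree → Tree
insert a leaf = node leaf a leaf
insert a (node l b r) with proj₁ a ≤? proj₁ b
... | yes _ = node (insert a l) b r
... | no  _ = node l b (insert a r)

-- rtree(a₁⋯a_k): insert a_k, …, a₁ in turn into the empty tree.
rtree : Word → Tree
rtree w = foldr insert leaf w

_≡sylv_ : Word → Word → Set
u ≡sylv v = rtree u ≡ rtree v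

module Submission where

open import Defs
open import Data.List using ([]; _∷_; _++_; foldr)
open import Data.List.Properties using (foldr-++)
open import Data.List.Relation.Unary.All as All using (All; []; _∷_)
open import Data.List.Relation.Unary.All.Properties using (++⁻)
open import Data.Nat using (suc; _≤_; _<_; _≤?_)
open import Data.Nat.Properties using (≤-refl; ≤-trans; <⇒≤; <⇒≱; <-cmp)
open import Function using (case_of_)
open import Data.Product using (_,_; proj₁; proj₂)
open import Relation.Binary using (tri<; tri≈; tri>)
open import Relation.Binary.PropositionalEquality using (_≡_; refl; sym; cong; module ≡-Reasoning)
open import Relation.Nullary using (¬_; yes; no; contradiction)

-- Call a letter a present in a tree when the search for a ends at a node labelled a.
-- Insertions preserve presence, and every letter of w is present in rtree w. Inserting two
-- present letters commutes: their search paths agree down to the node where they part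
-- and then grow disjoint subtrees. Now rtree (xyxy) and rtree (yxxy) arise from T = rtree (xy)
-- by inserting the letters of y and of x in the two possible orders, and all of them are
-- present in T.

≡-𝒜 : {a b : 𝒜} → proj₁ a ≡ proj₁ b → a ≡ b
≡-𝒜 {suc n , _} {.(suc n) , _} refl = refl

insert-≤ : ∀ {a c} l r → proj₁ a ≤ proj₁ c → insert a (node l c r) ≡ node (insert a l) c r
insert-≤ {a} {c} l r a≤c with proj₁ a ≤? proj₁ c
... | yes _ = refl
... | no a≰c = contradiction a≤c a≰c

insert-≰ : ∀ {a c} l r → ¬ proj₁ a ≤ proj₁ c → insert a (node l c r) ≡ node l c (insert a r)
insert-≰ {a} {c} l r a≰c with proj₁ a ≤? proj₁ c
... | yes a≤c = contradiction a≤c a≰c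
... | no _ = refl

infix 4 _∈ᵀ_

data _∈ᵀ_ (a : 𝒜) : Tree → Set where
  here  : ∀ {l r} → a ∈ᵀ node l a r
  left  : ∀ {l c r} → proj₁ a ≤ proj₁ c → a ∈ᵀ l → a ∈ᵀ node l c r
  right : ∀ {l c r} → ¬ proj₁ a ≤ proj₁ c → a ∈ᵀ r → a ∈ᵀ node l c r

∈ᵀ-insert : ∀ {a} b {T} → a ∈ᵀ T → a ∈ᵀ insert b T
∈ᵀ-insert {a} b here with proj₁ b ≤? proj₁ a
... | yes _ = here
... | no  _ = here
∈ᵀ-insert b (left {c = c} a≤c p) with proj₁ b ≤? proj₁ c
... | yes _ = left a≤c (∈ᵀ-insert b p)
... | no  _ = left a≤c p
∈ᵀ-insert b (right {c = c} a≰c p) with proj₁ b ≤? proj₁ c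
... | yes _ = right a≰c p
... | no  _ = right a≰c (∈ᵀ-insert b p)

insert-∈ᵀ : ∀ a T → a ∈ᵀ insert a T
insert-∈ᵀ a leaf = here
insert-∈ᵀ a (node l c r) with proj₁ a ≤? proj₁ c
... | yes a≤c = left a≤c (insert-∈ᵀ a l)
... | no  a≰c = right a≰c (insert-∈ᵀ a r)

insert-comm-node-≤ : ∀ {a b c} l r → proj₁ a ≤ proj₁ c → proj₁ b ≤ proj₁ c →
                     insert a (insert b l) ≡ insert b (insert a l) →
                     insert a (insert b (node l c r)) ≡ insert b (insert a (node l c r))
insert-comm-node-≤ {a} {b} {c} l r a≤c b≤c comm-l = begin
  insert a (insert b (node l c r))  ≡⟨ cong (insert a) (insert-≤ l r b≤c) ⟩
  insert a (node (insert b l) c r)  ≡⟨ insert-≤ (insert b l) r a≤c ⟩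
  node (insert a (insert b l)) c r  ≡⟨ cong (λ t → node t c r) comm-l ⟩
  node (insert b (insert a l)) c r  ≡⟨ insert-≤ (insert a l) r b≤c ⟨
  insert b (node (insert a l) c r)  ≡⟨ cong (insert b) (insert-≤ l r a≤c) ⟨
  insert b (insert a (node l c r))  ∎
  where open ≡-Reasoning

insert-comm-node-≰ : ∀ {a b c} l r → ¬ proj₁ a ≤ proj₁ c → ¬ proj₁ b ≤ proj₁ c →
                     insert a (insert b r) ≡ insert b (insert a r) →
                     insert a (insert b (node l c r)) ≡ insert b (insert a (node l c r))
insert-comm-node-≰ {a} {b} {c} l r a≰c b≰c comm-r = begin
  insert a (insert b (node l c r))  ≡⟨ cong (insert a) (insert-≰ l r b≰c) ⟩
  insert a (node l c (insert b r))  ≡⟨ insert-≰ l (insert b r) a≰c ⟩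
  node l c (insert a (insert b r))  ≡⟨ cong (node l c) comm-r ⟩
  node l c (insert b (insert a r))  ≡⟨ insert-≰ l (insert a r) b≰c ⟨
  insert b (node l c (insert a r))  ≡⟨ cong (insert b) (insert-≰ l r a≰c) ⟨
  insert b (insert a (node l c r))  ∎
  where open ≡-Reasoning

insert-comm-node-split : ∀ {a b c} l r → proj₁ b ≤ proj₁ c → ¬ proj₁ a ≤ proj₁ c →
                         insert a (insert b (node l c r)) ≡ insert b (insert a (node l c r))
insert-comm-node-split {a} {b} {c} l r b≤c a≰c = begin
  insert a (insert b (node l c r))  ≡⟨ cong (insert a) (insert-≤ l r b≤c) ⟩
  insert a (node (insert b l) c r)  ≡⟨ insert-≰ (insert b l) r a≰c ⟩
  node (insert b l) c (insert a r)  ≡⟨ insert-≤ l (insert a r) b≤c ⟨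
  insert b (node l c (insert a r))  ≡⟨ cong (insert b) (insert-≰ l r a≰c) ⟨
  insert b (insert a (node l c r))  ∎
  where open ≡-Reasoning

-- Only b needs to be present: a > b forces a's path off b's path no later than at b's node.
insert-comm-<-∈ᵀ : ∀ {a b T} → proj₁ b < proj₁ a → b ∈ᵀ T →
                   insert a (insert b T) ≡ insert b (insert a T)
insert-comm-<-∈ᵀ b<a (here {l} {r}) = insert-comm-node-split l r ≤-refl (<⇒≱ b<a)
insert-comm-<-∈ᵀ {a} b<a (left {l} {c} {r} b≤c p) = case proj₁ a ≤? proj₁ c of λ where
  (yes a≤c) → insert-comm-node-≤ l r a≤c b≤c (insert-comm-<-∈ᵀ b<a p)
  (no a≰c)  → insert-comm-node-split l r b≤c a≰c
insert-comm-<-∈ᵀ b<a (right {l} {c} {r} b≰c p) =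
  insert-comm-node-≰ l r (λ a≤c → b≰c (≤-trans (<⇒≤ b<a) a≤c)) b≰c (insert-comm-<-∈ᵀ b<a p)

insert-comm-∈ᵀ : ∀ {a b T} → a ∈ᵀ T → b ∈ᵀ T → insert a (insert b T) ≡ insert b (insert a T)
insert-comm-∈ᵀ {a} {b} a∈T b∈T with <-cmp (proj₁ a) (proj₁ b)
... | tri< a<b _ _ = sym (insert-comm-<-∈ᵀ a<b a∈T)
... | tri> _ _ b<a = insert-comm-<-∈ᵀ b<a b∈T
... | tri≈ _ a≡b _ with ≡-𝒜 {a} {b} a≡b
...   | refl = refl

insertAll : Word → Tree → Tree
insertAll u T = foldr insert T u

rtree-++ : ∀ u v → rtree (u ++ v) ≡ insertAll u (rtree v)
rtree-++ u v = foldr-++ insert leaf u v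

∈ᵀ-insertAll : ∀ {a} u {T} → a ∈ᵀ T → a ∈ᵀ insertAll u T
∈ᵀ-insertAll []      p = p
∈ᵀ-insertAll (b ∷ u) p = ∈ᵀ-insert b (∈ᵀ-insertAll u p)

∈ᵀ-rtree : ∀ w → All (_∈ᵀ rtree w) w
∈ᵀ-rtree []      = []
∈ᵀ-rtree (a ∷ w) = insert-∈ᵀ a (rtree w) ∷ All.map (∈ᵀ-insert a) (∈ᵀ-rtree w)

insertAll-comm-insert : ∀ {b T} u → b ∈ᵀ T → All (_∈ᵀ T) u →
                        insertAll u (insert b T) ≡ insert b (insertAll u T)
insertAll-comm-insert []      b∈T []           = refl
insertAll-comm-insert {b} {T} (a ∷ u) b∈T (a∈T ∷ u∈T) = begin
  insert a (insertAll u (insert b T))  ≡⟨ cong (insert a) (insertAll-comm-insert u b∈T u∈T) ⟩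
  insert a (insert b (insertAll u T))  ≡⟨ insert-comm-∈ᵀ (∈ᵀ-insertAll u a∈T) (∈ᵀ-insertAll u b∈T) ⟩
  insert b (insert a (insertAll u T))  ∎
  where open ≡-Reasoning

insertAll-comm : ∀ {T} u v → All (_∈ᵀ T) u → All (_∈ᵀ T) v →
                 insertAll u (insertAll v T) ≡ insertAll v (insertAll u T)
insertAll-comm u []      u∈T []           = refl
insertAll-comm {T} u (b ∷ v) u∈T (b∈T ∷ v∈T) = begin
  insertAll u (insert b (insertAll v T))  ≡⟨ insertAll-comm-insert u (∈ᵀ-insertAll v b∈T)
                                                (All.map (∈ᵀ-insertAll v) u∈T) ⟩
  insert b (insertAll u (insertAll v T))  ≡⟨ cong (insert b) (insertAll-comm u v u∈T v∈T) ⟩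
  insert b (insertAll v (insertAll u T))  ∎
  where open ≡-Reasoning

theorem4 : (x y : Word) → (x ++ y ++ x ++ y) ≡sylv (y ++ x ++ x ++ y)
theorem4 x y = begin
  rtree (x ++ y ++ x ++ y)           ≡⟨ rtree-++ x (y ++ x ++ y) ⟩
  insertAll x (rtree (y ++ x ++ y))  ≡⟨ cong (insertAll x) (rtree-++ y (x ++ y)) ⟩
  insertAll x (insertAll y T)        ≡⟨ insertAll-comm x y x∈T y∈T ⟩
  insertAll y (insertAll x T)        ≡⟨ cong (insertAll y) (rtree-++ x (x ++ y)) ⟨
  insertAll y (rtree (x ++ x ++ y))  ≡⟨ rtree-++ y (x ++ x ++ y) ⟨
  rtree (y ++ x ++ x ++ y)           ∎
  where
  open ≡-Reasoning
  T : Tree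
  T = rtree (x ++ y)
  x∈T : All (_∈ᵀ T) x
  x∈T = proj₁ (++⁻ x (∈ᵀ-rtree (x ++ y)))
  y∈T : All (_∈ᵀ T) y
  y∈T = proj₂ (++⁻ x (∈ᵀ-rtree (x ++ y)))
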